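{- For every integer $k \ge 1$, $\tau(8^k) \le 6^k$.
   Context: All graphs are simple, undirected and finite. A graph is word-representable if there is a word $w$ over its vertex set such that two distinct vertices are adjacent iff their occurrences alternate in $w$. For a graph $G$, $\eta(G)$ is the maximum cardinality of a set $S \subseteq V(G)$ such that the induced subgraph $G[S]$ is word-representable. For a positive integer $n$, $\tau(n) = \min\{\eta(G) : G \text{ is a graph on } n \text{ vertices}\}$. -}

module Defs where

open import Data.Nat using (ℕ; _≤_)
open import Data.Fin using (Fin; _≟_)
open import Data.Fin.Subset using (Subset; _∈_; ∣_∣)
open import Data.List using (List; []; _∷_)
open import Data.List.Membership.Propositional using () renaming (_∈_ to _∈ₗ_)
open import Data.List.Relation.Unary.All using (All)
open import Data.Product using (Σ; _×_)
open import Data.Unit using (⊤)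
open import Relation.Nullary using (¬_; yes; no)
open import Relation.Binary.PropositionalEquality using (_≡_)
open import Function.Bundles using (_⇔_)

record Graph (n : ℕ) : Set₁ where
  field
    Adj   : Fin n → Fin n → Set
    sym   : ∀ {x y} → Adj x y → Adj y x
    irrefl : ∀ {x} → ¬ Adj x x

restrict : {n : ℕ} → Fin n → Fin n → List (Fin n) → List (Fin n)
restrict x y [] = []
restrict x y (z ∷ w) with z ≟ x | z ≟ y
... | yes _ | _     = z ∷ restrict x y w
... | no _  | yes _ = z ∷ restrict x y w
... | no _  | no _  = restrict x y w

NoRepeat : {A : Set} → List A → Set
NoRepeat [] = ⊤
NoRepeat (a ∷ []) = ⊤
NoRepeat (a ∷ b ∷ w) = ¬ (a ≡ b) × NoRepeat (b ∷ w)

-- x and y alternate in w: after deleting all letters other than x and y,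
-- the result is of the form xyxy... or yxyx... (of even or odd length).
Alternate : {n : ℕ} → List (Fin n) → Fin n → Fin n → Set
Alternate w x y = NoRepeat (restrict x y w)

InducedWordRepresentable : {n : ℕ} → Graph n → Subset n → Set
InducedWordRepresentable {n} G S =
  Σ (List (Fin n)) λ w →
    All (λ z → z ∈ S) w ×
    (∀ x → x ∈ S → x ∈ₗ w) ×
    (∀ x y → x ∈ S → y ∈ S → ¬ (x ≡ y) → (Graph.Adj G x y ⇔ Alternate w x y))

-- η(G) ≤ m : every vertex set S inducing a word-representable subgraph
-- has |S| ≤ m  (η(G) is the maximum of such |S|).
ηAtMost : {n : ℕ} → Graph n → ℕ → Set
ηAtMost G m = ∀ S → InducedWordRepresentable G S → ∣ S ∣ ≤ m

-- τ(n) ≤ m : some graph G on n vertices has η(G) ≤ m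
-- (τ(n) is the minimum of η(G) over graphs on n vertices).
τAtMost : ℕ → ℕ → Set₁
τAtMost n m = Σ (Graph n) λ G → ηAtMost G m

{-# OPTIONS --safe #-}
-- Let c be a vertex of a word-representable graph and w a representing word.
-- The neighbours of c alternate with c, so between two consecutive occurrences
-- of c each of them occurs exactly once, and the order in which they occur there
-- is a transitive orientation of the neighbourhood of c.  The 5-cycle has no
-- transitive orientation, so the wheel W₅ is not word-representable.  The graph
-- G₈ below has four induced wheels, and every 7 of its vertices contain one, so
-- η(G₈) ≤ 6.  Finally η(G[H]) ≤ η(G) η(H) for the lexicographic product: a
-- representable set meets every copy of H in a representable set, and one
-- representative per copy met gives a representable set of G.  Hence the k-th
-- lexicographic power of G₈ has 8^k vertices and η at most 6^k.
module Submission where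

open import Defs
open import Data.Bool using (Bool; true; false; T)
import Data.Bool as Bool
open import Data.Empty using (⊥; ⊥-elim)
open import Data.Fin using (Fin; zero; suc; _≟_; combine; remQuot)
open import Data.Fin.Patterns using (0F; 1F; 2F; 3F; 4F; 5F; 6F; 7F)
open import Data.Fin.Properties
  using (any?; all?; remQuot-combine; combine-remQuot; combine-injectiveˡ; combine-injectiveʳ)
open import Data.Fin.Subset using (Subset; _∈_; ∣_∣; Nonempty) renaming (⊥ to ∅)
open import Data.Fin.Subset.Properties
  using (_∈?_; nonempty?; anySubset?; Empty-unique; ∣⊥∣≡0; ∣p∣≤n)
open import Data.List using (List; []; _∷_; take)
import Data.List as List
open import Data.List.Membership.Propositional using () renaming (_∈_ to _∈ₗ_)
open import Data.List.Relation.Unary.All using (All; []; _∷_)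
import Data.List.Relation.Unary.All as All
open import Data.List.Relation.Unary.Any using (here; there)
import Data.List.Relation.Unary.Any as Any
open import Data.Nat using (ℕ; zero; suc; _+_; _*_; _^_; _≤_; _≤?_; z≤n; s≤s; s≤s⁻¹)
open import Data.Nat.Properties
  using (≤-refl; ≤-trans; ≤-antisym; ≤-reflexive; +-mono-≤; *-monoˡ-≤; *-zeroʳ;
         module ≤-Reasoning)
open import Data.Product using (_×_; _,_; proj₁; proj₂; ∃)
import Data.Product as Product
open import Data.Product.Function.NonDependent.Propositional using (_×-⇔_)
open import Data.Sum using (_⊎_; inj₁; inj₂; [_,_]′)
import Data.Sum as Sum
open import Data.Sum.Function.Propositional using (_⊎-⇔_)
open import Data.Unit using (⊤; tt)
open import Data.Vec using (Vec; []; _∷_)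
import Data.Vec as Vec
open import Data.Vec.Properties
  using (lookup∘tabulate; tabulate∘lookup; tabulate-cong; lookup-concat; []=⇒lookup; lookup⇒[]=)
open import Function using (_∘_; const; id)
open import Function.Bundles using (_⇔_; mk⇔; Equivalence)
open import Function.Construct.Composition using (_⇔-∘_)
open import Function.Construct.Identity using (⇔-id)
open import Function.Construct.Symmetry using (⇔-sym)
open import Function.Definitions using (Injective)
open import Function.Related.Propositional using (module EquationalReasoning)
open import Relation.Nullary using (¬_; yes; no; Dec; does)
open import Relation.Nullary.Decidable
  using (T?; ¬?; _×-dec_; _⊎-dec_; toWitness; toWitnessFalse; decidable-stable)
open import Relation.Binary.PropositionalEquality
  using (_≡_; _≢_; refl; sym; trans; cong; cong₂; subst; subst₂; module ≡-Reasoning)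

private
  variable
    n : ℕ
    x y z : Fin n
    w : List (Fin n)

-- Alternation in terms of prefix counts

restrict-comm : (x y : Fin n) (w : List (Fin n)) → restrict x y w ≡ restrict y x w
restrict-comm x y [] = refl
restrict-comm x y (z ∷ w) with z ≟ x | z ≟ y
... | yes _ | yes _ = cong (z ∷_) (restrict-comm x y w)
... | yes _ | no _  = cong (z ∷_) (restrict-comm x y w)
... | no _  | yes _ = cong (z ∷_) (restrict-comm x y w)
... | no _  | no _  = restrict-comm x y w

restrict-∷-kept : z ≡ x ⊎ z ≡ y → restrict x y (z ∷ w) ≡ z ∷ restrict x y w
restrict-∷-kept {z = z} {x} {y} z∈xy with z ≟ x | z ≟ y
... | yes _   | _       = refl
... | no _    | yes _   = refl
... | no z≢x  | no z≢y  = ⊥-elim ([ z≢x , z≢y ]′ z∈xy)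

restrict-∷-dropped : z ≢ x → z ≢ y → restrict x y (z ∷ w) ≡ restrict x y w
restrict-∷-dropped {z = z} {x} {y} z≢x z≢y with z ≟ x | z ≟ y
... | yes z≡x | _       = ⊥-elim (z≢x z≡x)
... | no _    | yes z≡y = ⊥-elim (z≢y z≡y)
... | no _    | no _    = refl

restrict-⊆ : (x y : Fin n) (w : List (Fin n)) → All (λ z → z ≡ x ⊎ z ≡ y) (restrict x y w)
restrict-⊆ x y [] = []
restrict-⊆ x y (z ∷ w) with z ≟ x | z ≟ y
... | yes z≡x | _       = inj₁ z≡x ∷ restrict-⊆ x y w
... | no _    | yes z≡y = inj₂ z≡y ∷ restrict-⊆ x y w
... | no _    | no _    = restrict-⊆ x y w

occ : Fin n → List (Fin n) → ℕ
occ x [] = 0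
occ x (z ∷ w) with z ≟ x
... | yes _ = suc (occ x w)
... | no _  = occ x w

occ-∷-≡ : z ≡ x → occ x (z ∷ w) ≡ suc (occ x w)
occ-∷-≡ {z = z} {x} z≡x with z ≟ x
... | yes _   = refl
... | no z≢x  = ⊥-elim (z≢x z≡x)

occ-∷-≢ : z ≢ x → occ x (z ∷ w) ≡ occ x w
occ-∷-≢ {z = z} {x} z≢x with z ≟ x
... | yes z≡x = ⊥-elim (z≢x z≡x)
... | no _    = refl

-- Unlike restrict x y w, prefix counts of different pairs of letters live in
-- the same word, so alternation facts about different pairs can be chained
-- (neverBehind-trans, neverTwoAhead-shortcut).
NeverBehind : List (Fin n) → Fin n → Fin n → Set
NeverBehind w x y = ∀ k → occ y (take k w) ≤ occ x (take k w)

NeverTwoAhead : List (Fin n) → Fin n → Fin n → Set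
NeverTwoAhead w x y = ∀ k → occ x (take k w) ≤ suc (occ y (take k w))

Leads : List (Fin n) → Fin n → Fin n → Set
Leads w x y = NeverBehind w x y × NeverTwoAhead w x y

neverBehind-refl : NeverBehind w x x
neverBehind-refl k = ≤-refl

neverBehind-trans : NeverBehind w x y → NeverBehind w y z → NeverBehind w x z
neverBehind-trans x≽y y≽z k = ≤-trans (y≽z k) (x≽y k)

neverTwoAhead-shortcut : ∀ {u v a b : Fin n} →
  NeverBehind w u a → NeverTwoAhead w u v → NeverBehind w b v → NeverTwoAhead w a b
neverTwoAhead-shortcut u≽a u≤v+1 b≽v k = ≤-trans (u≽a k) (≤-trans (u≤v+1 k) (s≤s (b≽v k)))

leads-[] : Leads [] x y
leads-[] = (λ { zero → z≤n ; (suc k) → z≤n }) , (λ { zero → z≤n ; (suc k) → z≤n })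

prefixes-∷ : {A : Set} {z : A} {w : List A} (R R′ : List A → Set) →
  R [] → (∀ p → R (z ∷ p) ⇔ R′ p) →
  (∀ k → R (take k (z ∷ w))) ⇔ (∀ k → R′ (take k w))
prefixes-∷ R R′ R[] R∷⇔R′ = mk⇔
  (λ h k → Equivalence.to (R∷⇔R′ _) (h (suc k)))
  (λ { h zero → R[] ; h (suc k) → Equivalence.from (R∷⇔R′ _) (h k) })

module _ (z≢x : z ≢ x) (z≢y : z ≢ y) where

  neverBehind-∷-other : NeverBehind (z ∷ w) x y ⇔ NeverBehind w x y
  neverBehind-∷-other = prefixes-∷ (λ p → occ y p ≤ occ x p) _ z≤n step
    where
    step : ∀ p → occ y (z ∷ p) ≤ occ x (z ∷ p) ⇔ occ y p ≤ occ x p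
    step p rewrite occ-∷-≢ {w = p} z≢x | occ-∷-≢ {w = p} z≢y = ⇔-id _

  neverTwoAhead-∷-other : NeverTwoAhead (z ∷ w) x y ⇔ NeverTwoAhead w x y
  neverTwoAhead-∷-other = prefixes-∷ (λ p → occ x p ≤ suc (occ y p)) _ z≤n step
    where
    step : ∀ p → occ x (z ∷ p) ≤ suc (occ y (z ∷ p)) ⇔ occ x p ≤ suc (occ y p)
    step p rewrite occ-∷-≢ {w = p} z≢x | occ-∷-≢ {w = p} z≢y = ⇔-id _

  leads-∷-other : Leads (z ∷ w) x y ⇔ Leads w x y
  leads-∷-other = neverBehind-∷-other ×-⇔ neverTwoAhead-∷-other

module _ (z≡x : z ≡ x) (z≢y : z ≢ y) where

  neverBehind-∷-self : NeverBehind (z ∷ w) x y ⇔ NeverTwoAhead w y x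
  neverBehind-∷-self = prefixes-∷ (λ p → occ y p ≤ occ x p) _ z≤n step
    where
    step : ∀ p → occ y (z ∷ p) ≤ occ x (z ∷ p) ⇔ occ y p ≤ suc (occ x p)
    step p rewrite occ-∷-≡ {w = p} z≡x | occ-∷-≢ {w = p} z≢y = ⇔-id _

  neverTwoAhead-∷-self : NeverTwoAhead (z ∷ w) x y ⇔ NeverBehind w y x
  neverTwoAhead-∷-self = prefixes-∷ (λ p → occ x p ≤ suc (occ y p)) _ z≤n step
    where
    step : ∀ p → occ x (z ∷ p) ≤ suc (occ y (z ∷ p)) ⇔ occ x p ≤ occ y p
    step p rewrite occ-∷-≡ {w = p} z≡x | occ-∷-≢ {w = p} z≢y = mk⇔ s≤s⁻¹ s≤s

  leads-∷-self : Leads (z ∷ w) x y ⇔ Leads w y x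
  leads-∷-self =
    mk⇔ Product.swap Product.swap ⇔-∘ (neverBehind-∷-self ×-⇔ neverTwoAhead-∷-self)

  ¬leads-∷-other : ¬ Leads (z ∷ w) y x
  ¬leads-∷-other (y≽x , _)
    with subst₂ _≤_ (occ-∷-≡ {w = []} z≡x) (occ-∷-≢ {w = []} z≢y) (y≽x 1)
  ... | ()

neverBehind-antisym : NeverBehind w x y → NeverBehind w y x → x ∈ₗ w → x ≡ y
neverBehind-antisym {w = z ∷ w} {x} {y} x≽y y≽x x∈w
  with z ≟ x | z ≟ y | ≤-antisym (y≽x 1) (x≽y 1)
... | yes z≡x | yes z≡y | _ = trans (sym z≡x) z≡y
... | no z≢x  | no z≢y  | _ with x∈w
...   | here x≡z   = ⊥-elim (z≢x (sym x≡z))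
...   | there x∈w′ = neverBehind-antisym
        (Equivalence.to (neverBehind-∷-other z≢x z≢y) x≽y)
        (Equivalence.to (neverBehind-∷-other z≢y z≢x) y≽x) x∈w′

Alternating : Fin n → Fin n → List (Fin n) → Set
Alternating x y []      = ⊤
Alternating x y (z ∷ l) = z ≡ x × Alternating y x l

alternating⇒noRepeat : x ≢ y → (l : List (Fin n)) → Alternating x y l → NoRepeat l
alternating⇒noRepeat x≢y []           _                  = tt
alternating⇒noRepeat x≢y (z ∷ [])     _                  = tt
alternating⇒noRepeat x≢y (z ∷ z′ ∷ l) (z≡x , z′≡y , alt) =
  (λ z≡z′ → x≢y (trans (sym z≡x) (trans z≡z′ z′≡y))) ,
  alternating⇒noRepeat (x≢y ∘ sym) (z′ ∷ l) (z′≡y , alt)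

alternating-∷ : {l : List (Fin n)} → z ≡ x → All (λ z → z ≡ x ⊎ z ≡ y) l →
  NoRepeat (z ∷ l) → Alternating x y (z ∷ l)
alternating-∷ z≡x []             _           = z≡x , tt
alternating-∷ z≡x (z′∈xy ∷ l∈xy) (z≢z′ , nr) =
  z≡x , alternating-∷ z′≡y (All.map Sum.swap l∈xy) nr
  where
  z′≡y = [ (λ z′≡x → ⊥-elim (z≢z′ (trans z≡x (sym z′≡x)))) , id ]′ z′∈xy

noRepeat⇒alternating : {l : List (Fin n)} → All (λ z → z ≡ x ⊎ z ≡ y) l → NoRepeat l →
  Alternating x y l ⊎ Alternating y x l
noRepeat⇒alternating []                 _  = inj₁ tt
noRepeat⇒alternating (inj₁ z≡x ∷ l∈xy) nr = inj₁ (alternating-∷ z≡x l∈xy nr)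
noRepeat⇒alternating (inj₂ z≡y ∷ l∈xy) nr =
  inj₂ (alternating-∷ z≡y (All.map Sum.swap l∈xy) nr)

alternating⇔leads : x ≢ y → (w : List (Fin n)) → Alternating x y (restrict x y w) ⇔ Leads w x y
alternating⇔leads _ [] = mk⇔ (const leads-[]) (const tt)
alternating⇔leads {x = x} {y} x≢y (z ∷ w) with z ≟ x | z ≟ y
... | yes z≡x | _ = begin
  (z ≡ x × Alternating y x (restrict x y w)) ∼⟨ mk⇔ proj₂ (z≡x ,_) ⟩
  Alternating y x (restrict x y w)           ≡⟨ cong (Alternating y x) (restrict-comm x y w) ⟩
  Alternating y x (restrict y x w)           ∼⟨ alternating⇔leads (x≢y ∘ sym) w ⟩
  Leads w y x                                ∼⟨ ⇔-sym (leads-∷-self z≡x (x≢y ∘ trans (sym z≡x))) ⟩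
  Leads (z ∷ w) x y                          ∎
  where open EquationalReasoning
... | no z≢x | yes z≡y =
  mk⇔ (λ (z≡x , _) → ⊥-elim (z≢x z≡x)) (⊥-elim ∘ ¬leads-∷-other z≡y z≢x)
... | no z≢x | no z≢y = ⇔-sym (leads-∷-other z≢x z≢y) ⇔-∘ alternating⇔leads x≢y w

alternate⇔leads : x ≢ y → (w : List (Fin n)) → Alternate w x y ⇔ (Leads w x y ⊎ Leads w y x)
alternate⇔leads {x = x} {y} x≢y w = begin
  NoRepeat (restrict x y w)
    ∼⟨ mk⇔ (noRepeat⇒alternating (restrict-⊆ x y w))
           [ alternating⇒noRepeat x≢y _ , alternating⇒noRepeat (x≢y ∘ sym) _ ]′ ⟩
  (Alternating x y (restrict x y w) ⊎ Alternating y x (restrict x y w))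
    ≡⟨ cong (λ r → Alternating x y (restrict x y w) ⊎ Alternating y x r) (restrict-comm x y w) ⟩
  (Alternating x y (restrict x y w) ⊎ Alternating y x (restrict y x w))
    ∼⟨ alternating⇔leads x≢y w ⊎-⇔ alternating⇔leads (x≢y ∘ sym) w ⟩
  (Leads w x y ⊎ Leads w y x)
    ∎
  where open EquationalReasoning

-- Wheels are not word-representable

-- The neighbours of c are those led by c (after c) and those leading c (before
-- c); Precedes y z says that y occurs before z between consecutive occurrences of c.
module _ (w : List (Fin n)) (c : Fin n) where

  data Precedes : Fin n → Fin n → Set where
    after-after   : Leads w c y → Leads w c z → Leads w y z → Precedes y z
    before-before : Leads w y c → Leads w z c → Leads w y z → Precedes y z
    after-before  : Leads w c y → Leads w z c → Leads w z y → Precedes y z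

module _ {w : List (Fin n)} {c : Fin n} (c∈w : c ∈ₗ w) where

  private
    one-side : y ≢ c → NeverBehind w c y → NeverBehind w y c → ⊥
    one-side y≢c c≽y y≽c = y≢c (sym (neverBehind-antisym c≽y y≽c c∈w))

    both-sides : y ≢ c → Leads w c y → Leads w y c → ⊥
    both-sides y≢c cy yc = one-side y≢c (proj₁ cy) (proj₁ yc)

  precedes-total : y ≢ c → z ≢ c →
    Leads w c y ⊎ Leads w y c → Leads w c z ⊎ Leads w z c → Leads w y z ⊎ Leads w z y →
    Precedes w c y z ⊎ Precedes w c z y
  precedes-total _ _ (inj₁ cy) (inj₁ cz) (inj₁ yz) = inj₁ (after-after cy cz yz)
  precedes-total _ _ (inj₁ cy) (inj₁ cz) (inj₂ zy) = inj₂ (after-after cz cy zy)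
  precedes-total _ _ (inj₂ yc) (inj₂ zc) (inj₁ yz) = inj₁ (before-before yc zc yz)
  precedes-total _ _ (inj₂ yc) (inj₂ zc) (inj₂ zy) = inj₂ (before-before zc yc zy)
  precedes-total _ _ (inj₁ cy) (inj₂ zc) (inj₂ zy) = inj₁ (after-before cy zc zy)
  precedes-total _ _ (inj₂ yc) (inj₁ cz) (inj₁ yz) = inj₂ (after-before cz yc yz)
  precedes-total y≢c _ (inj₁ cy) (inj₂ zc) (inj₁ yz) =
    ⊥-elim (one-side y≢c (proj₁ cy) (neverBehind-trans (proj₁ yz) (proj₁ zc)))
  precedes-total _ z≢c (inj₂ yc) (inj₁ cz) (inj₂ zy) =
    ⊥-elim (one-side z≢c (proj₁ cz) (neverBehind-trans (proj₁ zy) (proj₁ yc)))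

  precedes-trans : ∀ {u} → z ≢ c → Precedes w c y z → Precedes w c z u →
    Leads w y u ⊎ Leads w u y
  precedes-trans _ (after-after cy _ yz) (after-after _ cu zu) = inj₁
    ( neverBehind-trans (proj₁ yz) (proj₁ zu)
    , neverTwoAhead-shortcut (proj₁ cy) (proj₂ cu) neverBehind-refl )
  precedes-trans _ (before-before yc _ yz) (before-before _ uc zu) = inj₁
    ( neverBehind-trans (proj₁ yz) (proj₁ zu)
    , neverTwoAhead-shortcut neverBehind-refl (proj₂ yc) (proj₁ uc) )
  precedes-trans _ (after-after cy _ yz) (after-before _ uc uz) = inj₂
    ( neverBehind-trans (proj₁ uc) (proj₁ cy)
    , neverTwoAhead-shortcut neverBehind-refl (proj₂ uz) (proj₁ yz) )
  precedes-trans _ (after-before cy _ zy) (before-before _ uc zu) = inj₂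
    ( neverBehind-trans (proj₁ uc) (proj₁ cy)
    , neverTwoAhead-shortcut (proj₁ zu) (proj₂ zy) neverBehind-refl )
  precedes-trans z≢c (after-after _ cz _)   (before-before zc _ _) = ⊥-elim (both-sides z≢c cz zc)
  precedes-trans z≢c (after-before _ zc _)  (after-after cz _ _)   = ⊥-elim (both-sides z≢c cz zc)
  precedes-trans z≢c (after-before _ zc _)  (after-before cz _ _)  = ⊥-elim (both-sides z≢c cz zc)
  precedes-trans z≢c (before-before _ zc _) (after-after cz _ _)   = ⊥-elim (both-sides z≢c cz zc)
  precedes-trans z≢c (before-before _ zc _) (after-before cz _ _)  = ⊥-elim (both-sides z≢c cz zc)

next : Fin 5 → Fin 5
next 0F = 1F
next 1F = 2F
next 2F = 3F
next 3F = 4F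
next 4F = 0F

-- Since 5 is odd, the choices cannot alternate all the way round the cycle.
odd-cycle-consecutive : {A B : Fin 5 → Set} → (∀ i → A i ⊎ B i) →
  ∃ λ i → (A i × A (next i)) ⊎ (B i × B (next i))
odd-cycle-consecutive choice with choice 0F | choice 1F | choice 2F | choice 3F | choice 4F
... | inj₁ a  | inj₁ a′ | _       | _       | _       = 0F , inj₁ (a , a′)
... | inj₂ b  | inj₂ b′ | _       | _       | _       = 0F , inj₂ (b , b′)
... | _       | inj₁ a  | inj₁ a′ | _       | _       = 1F , inj₁ (a , a′)
... | _       | inj₂ b  | inj₂ b′ | _       | _       = 1F , inj₂ (b , b′)
... | _       | _       | inj₁ a  | inj₁ a′ | _       = 2F , inj₁ (a , a′)
... | _       | _       | inj₂ b  | inj₂ b′ | _       = 2F , inj₂ (b , b′)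
... | _       | _       | _       | inj₁ a  | inj₁ a′ = 3F , inj₁ (a , a′)
... | _       | _       | _       | inj₂ b  | inj₂ b′ = 3F , inj₂ (b , b′)
... | inj₁ a′ | _       | _       | _       | inj₁ a  = 4F , inj₁ (a , a′)
... | inj₂ b′ | _       | _       | _       | inj₂ b  = 4F , inj₂ (b , b′)

adjacent⇒distinct : (G : Graph n) → Graph.Adj G x y → x ≢ y
adjacent⇒distinct G xy refl = Graph.irrefl G xy

record Wheel (G : Graph n) : Set where
  open Graph G using (Adj)
  field
    hub             : Fin n
    rim             : Fin 5 → Fin n
    spoke           : ∀ i → Adj hub (rim i)
    rim-adjacent    : ∀ i → Adj (rim i) (rim (next i))
    rim-nonadjacent : ∀ i → ¬ Adj (rim i) (rim (next (next i)))
    rim-distinct    : ∀ i → rim i ≢ rim (next (next i))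

wheel-not-representable : {G : Graph n} (W : Wheel G) {S : Subset n} →
  Wheel.hub W ∈ S → (∀ i → Wheel.rim W i ∈ S) → ¬ InducedWordRepresentable G S
wheel-not-representable {G = G} W {S} hub∈S rim∈S (w , _ , S⊆w , adj⇔alt) =
  let i , chord = rim-chord in
  rim-nonadjacent i (leads⇒adjacent (rim∈S i) (rim∈S (next (next i))) (rim-distinct i) chord)
  where
  open Graph G using (Adj)
  open Wheel W

  adjacent⇒leads : x ∈ S → y ∈ S → Adj x y → Leads w x y ⊎ Leads w y x
  adjacent⇒leads x∈S y∈S xy = Equivalence.to (alternate⇔leads x≢y w)
    (Equivalence.to (adj⇔alt _ _ x∈S y∈S x≢y) xy)
    where x≢y = adjacent⇒distinct G xy

  leads⇒adjacent : x ∈ S → y ∈ S → x ≢ y → Leads w x y ⊎ Leads w y x → Adj x y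
  leads⇒adjacent x∈S y∈S x≢y lead = Equivalence.from (adj⇔alt _ _ x∈S y∈S x≢y)
    (Equivalence.from (alternate⇔leads x≢y w) lead)

  hub∈w : hub ∈ₗ w
  hub∈w = S⊆w hub hub∈S

  rim≢hub : ∀ i → rim i ≢ hub
  rim≢hub i = adjacent⇒distinct G (spoke i) ∘ sym

  side : ∀ i → Leads w hub (rim i) ⊎ Leads w (rim i) hub
  side i = adjacent⇒leads hub∈S (rim∈S i) (spoke i)

  rim-order : ∀ i → Precedes w hub (rim i) (rim (next i)) ⊎ Precedes w hub (rim (next i)) (rim i)
  rim-order i = precedes-total hub∈w (rim≢hub i) (rim≢hub (next i)) (side i) (side (next i))
    (adjacent⇒leads (rim∈S i) (rim∈S (next i)) (rim-adjacent i))

  rim-chord : ∃ λ i → Leads w (rim i) (rim (next (next i))) ⊎ Leads w (rim (next (next i))) (rim i)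
  rim-chord with odd-cycle-consecutive rim-order
  ... | i , inj₁ (p , p′) = i , precedes-trans hub∈w (rim≢hub (next i)) p p′
  ... | i , inj₂ (p , p′) = i , Sum.swap (precedes-trans hub∈w (rim≢hub (next i)) p′ p)

-- Pulling a representing word back along an induced embedding

noRepeat-map⇔ : {A B : Set} {f : A → B} → Injective _≡_ _≡_ f →
  (l : List A) → NoRepeat (List.map f l) ⇔ NoRepeat l
noRepeat-map⇔ f-inj []          = mk⇔ id id
noRepeat-map⇔ f-inj (a ∷ [])    = mk⇔ id id
noRepeat-map⇔ {f = f} f-inj (a ∷ b ∷ l) =
  mk⇔ (λ fa≢fb → fa≢fb ∘ cong f) (λ a≢b → a≢b ∘ f-inj) ×-⇔
  noRepeat-map⇔ f-inj (b ∷ l)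

module Pullback {m : ℕ} (G : Graph m) (H : Graph n) (f : Fin m → Fin n)
  (f-injective : Injective _≡_ _≡_ f)
  (T : Subset m) (S : Subset n) (f[T]⊆S : ∀ {a} → a ∈ T → f a ∈ S)
  (f-adj : ∀ {a b} → a ∈ T → b ∈ T → a ≢ b → Graph.Adj G a b ⇔ Graph.Adj H (f a) (f b))
  where

  preimage? : (z : Fin n) → Dec (∃ λ a → a ∈ T × f a ≡ z)
  preimage? z = any? (λ a → (a ∈? T) ×-dec (f a ≟ z))

  pull : List (Fin n) → List (Fin m)
  pull [] = []
  pull (z ∷ w) with preimage? z
  ... | yes (a , _) = a ∷ pull w
  ... | no _        = pull w

  pull-⊆ : ∀ w → All (_∈ T) (pull w)
  pull-⊆ [] = []
  pull-⊆ (z ∷ w) with preimage? z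
  ... | yes (_ , a∈T , _) = a∈T ∷ pull-⊆ w
  ... | no _              = pull-⊆ w

  pull-⊇ : ∀ {a} w → a ∈ T → f a ∈ₗ w → a ∈ₗ pull w
  pull-⊇ (z ∷ w) a∈T fa∈w with preimage? z | fa∈w
  ... | yes (a′ , _ , fa′≡z) | here fa≡z   = here (f-injective (trans fa≡z (sym fa′≡z)))
  ... | yes _               | there fa∈w′ = there (pull-⊇ w a∈T fa∈w′)
  ... | no ∄a               | here fa≡z   = ⊥-elim (∄a (_ , a∈T , fa≡z))
  ... | no _                | there fa∈w′ = pull-⊇ w a∈T fa∈w′

  map-restrict-pull : ∀ {a b} → a ∈ T → b ∈ T → ∀ w →
    List.map f (restrict a b (pull w)) ≡ restrict (f a) (f b) w
  map-restrict-pull a∈T b∈T [] = refl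
  map-restrict-pull {a} {b} a∈T b∈T (z ∷ w) with preimage? z
  ... | yes (a′ , _ , fa′≡z) with (a′ ≟ a) ⊎-dec (a′ ≟ b)
  ...   | yes a′∈ab = begin
    List.map f (restrict a b (a′ ∷ pull w))
      ≡⟨ cong (List.map f) (restrict-∷-kept a′∈ab) ⟩
    f a′ ∷ List.map f (restrict a b (pull w))
      ≡⟨ cong₂ _∷_ fa′≡z (map-restrict-pull a∈T b∈T w) ⟩
    z ∷ restrict (f a) (f b) w
      ≡⟨ restrict-∷-kept (Sum.map z≡f z≡f a′∈ab) ⟨
    restrict (f a) (f b) (z ∷ w)
      ∎
    where
    open ≡-Reasoning
    z≡f : ∀ {c} → a′ ≡ c → z ≡ f c
    z≡f a′≡c = trans (sym fa′≡z) (cong f a′≡c)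
  ...   | no a′∉ab = begin
    List.map f (restrict a b (a′ ∷ pull w))
      ≡⟨ cong (List.map f) (restrict-∷-dropped (a′∉ab ∘ inj₁) (a′∉ab ∘ inj₂)) ⟩
    List.map f (restrict a b (pull w))
      ≡⟨ map-restrict-pull a∈T b∈T w ⟩
    restrict (f a) (f b) w
      ≡⟨ restrict-∷-dropped (a′∉ab ∘ inj₁ ∘ z≡f⇒) (a′∉ab ∘ inj₂ ∘ z≡f⇒) ⟨
    restrict (f a) (f b) (z ∷ w)
      ∎
    where
    open ≡-Reasoning
    z≡f⇒ : ∀ {c} → z ≡ f c → a′ ≡ c
    z≡f⇒ z≡fc = f-injective (trans fa′≡z z≡fc)
  map-restrict-pull {a} {b} a∈T b∈T (z ∷ w) | no ∄a = begin
    List.map f (restrict a b (pull w)) ≡⟨ map-restrict-pull a∈T b∈T w ⟩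
    restrict (f a) (f b) w             ≡⟨ restrict-∷-dropped (∄a ∘ (a ,_) ∘ (a∈T ,_) ∘ sym)
                                                             (∄a ∘ (b ,_) ∘ (b∈T ,_) ∘ sym) ⟨
    restrict (f a) (f b) (z ∷ w)       ∎
    where open ≡-Reasoning

  pullback : InducedWordRepresentable H S → InducedWordRepresentable G T
  pullback (w , _ , S⊆w , adj⇔alt) =
    pull w , pull-⊆ w , (λ a a∈T → pull-⊇ w a∈T (S⊆w (f a) (f[T]⊆S a∈T))) , adj⇔alt′
    where
    adj⇔alt′ : ∀ a b → a ∈ T → b ∈ T → a ≢ b → Graph.Adj G a b ⇔ Alternate (pull w) a b
    adj⇔alt′ a b a∈T b∈T a≢b = begin
      Graph.Adj G a b
        ∼⟨ f-adj a∈T b∈T a≢b ⟩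
      Graph.Adj H (f a) (f b)
        ∼⟨ adj⇔alt (f a) (f b) (f[T]⊆S a∈T) (f[T]⊆S b∈T) (a≢b ∘ f-injective) ⟩
      NoRepeat (restrict (f a) (f b) w)
        ≡⟨ cong NoRepeat (map-restrict-pull a∈T b∈T w) ⟨
      NoRepeat (List.map f (restrict a b (pull w)))
        ∼⟨ noRepeat-map⇔ f-injective _ ⟩
      NoRepeat (restrict a b (pull w))
        ∎
      where open EquationalReasoning

-- Lexicographic products

-- The vertex (a , i) of G[H] is encoded as combine a i : Fin (p * m).
module _ {p m : ℕ} (G : Graph p) (H : Graph m) where

  LexAdj : Fin p × Fin m → Fin p × Fin m → Set
  LexAdj (a , i) (b , j) = Graph.Adj G a b ⊎ (a ≡ b × Graph.Adj H i j)

  lex : Graph (p * m)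
  lex = record
    { Adj    = λ x y → LexAdj (remQuot m x) (remQuot m y)
    ; sym    = λ {x} {y} → lexAdj-sym (remQuot m x) (remQuot m y)
    ; irrefl = λ {x} → lexAdj-irrefl (remQuot m x)
    }
    where
    lexAdj-sym : ∀ u v → LexAdj u v → LexAdj v u
    lexAdj-sym _ _ (inj₁ ab)         = inj₁ (Graph.sym G ab)
    lexAdj-sym _ _ (inj₂ (a≡b , ij)) = inj₂ (sym a≡b , Graph.sym H ij)
    lexAdj-irrefl : ∀ u → ¬ LexAdj u u
    lexAdj-irrefl _ (inj₁ aa)       = Graph.irrefl G aa
    lexAdj-irrefl _ (inj₂ (_ , ii)) = Graph.irrefl H ii

  lex-adj : ∀ a b i j → Graph.Adj lex (combine a i) (combine b j) ⇔ LexAdj (a , i) (b , j)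
  lex-adj a b i j = mk⇔ (subst₂ LexAdj ai bj) (subst₂ LexAdj (sym ai) (sym bj))
    where
    ai = remQuot-combine {p} {m} a i
    bj = remQuot-combine {p} {m} b j

  lex-adj-fibre : ∀ a i j → Graph.Adj lex (combine a i) (combine a j) ⇔ Graph.Adj H i j
  lex-adj-fibre a i j =
    mk⇔ [ ⊥-elim ∘ Graph.irrefl G , proj₂ ]′ (inj₂ ∘ (refl ,_)) ⇔-∘ lex-adj a a i j

  lex-adj-base : ∀ {a b} i j → a ≢ b → Graph.Adj lex (combine a i) (combine b j) ⇔ Graph.Adj G a b
  lex-adj-base i j a≢b = mk⇔ [ id , ⊥-elim ∘ a≢b ∘ proj₁ ]′ inj₁ ⇔-∘ lex-adj _ _ i j

block : {p m : ℕ} → Subset (p * m) → Fin p → Subset m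
block S a = Vec.tabulate (λ j → Vec.lookup S (combine a j))

∈-block : {p m : ℕ} {S : Subset (p * m)} {a : Fin p} {j : Fin m} →
  j ∈ block S a ⇔ combine a j ∈ S
∈-block {S = S} {a} {j} = mk⇔
  (λ j∈ → lookup⇒[]= _ S (trans (sym (lookup∘tabulate _ j)) ([]=⇒lookup j∈)))
  (λ aj∈S → lookup⇒[]= j _ (trans (lookup∘tabulate _ j) ([]=⇒lookup aj∈S)))

concat-blocks : {p m : ℕ} (S : Subset (p * m)) → Vec.concat (Vec.tabulate (block {p} {m} S)) ≡ S
concat-blocks {p} {m} S =
  trans (sym (tabulate∘lookup _)) (trans (tabulate-cong pointwise) (tabulate∘lookup S))
  where
  open ≡-Reasoning
  bs = Vec.tabulate (block {p} {m} S)
  pointwise : ∀ x → Vec.lookup (Vec.concat bs) x ≡ Vec.lookup S x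
  pointwise x = begin
    Vec.lookup (Vec.concat bs) x
      ≡⟨ cong (Vec.lookup (Vec.concat bs)) (combine-remQuot {p} m x) ⟨
    Vec.lookup (Vec.concat bs) (combine a j)
      ≡⟨ lookup-concat bs a j ⟩
    Vec.lookup (Vec.lookup bs a) j
      ≡⟨ cong (λ b → Vec.lookup b j) (lookup∘tabulate _ a) ⟩
    Vec.lookup (block S a) j
      ≡⟨ lookup∘tabulate _ j ⟩
    Vec.lookup S (combine a j)
      ≡⟨ cong (Vec.lookup S) (combine-remQuot {p} m x) ⟩
    Vec.lookup S x
      ∎
    where
    a = proj₁ (remQuot {p} m x)
    j = proj₂ (remQuot {p} m x)

∣++∣ : {m k : ℕ} (xs : Subset m) (ys : Subset k) → ∣ xs Vec.++ ys ∣ ≡ ∣ xs ∣ + ∣ ys ∣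
∣++∣ []           ys = refl
∣++∣ (true ∷ xs)  ys = cong suc (∣++∣ xs ys)
∣++∣ (false ∷ xs) ys = ∣++∣ xs ys

support : {p m : ℕ} → (Fin p → Subset m) → Subset p
support bs = Vec.tabulate (λ a → does (nonempty? (bs a)))

∈-support : {p m : ℕ} {bs : Fin p → Subset m} {a : Fin p} → a ∈ support bs → Nonempty (bs a)
∈-support {bs = bs} {a} a∈
  with nonempty? (bs a) | trans (sym (lookup∘tabulate _ a)) ([]=⇒lookup a∈)
... | yes ne | _  = ne
... | no _   | ()

∣concat∣≤∣support∣* : {p m B : ℕ} (bs : Fin p → Subset m) → (∀ a → ∣ bs a ∣ ≤ B) →
  ∣ Vec.concat (Vec.tabulate bs) ∣ ≤ ∣ support bs ∣ * B
∣concat∣≤∣support∣* {zero}  bs _ = z≤n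
∣concat∣≤∣support∣* {suc p} {m} {B} bs bound with nonempty? (bs zero)
... | yes _ = begin
  ∣ bs zero Vec.++ rest ∣        ≡⟨ ∣++∣ (bs zero) rest ⟩
  ∣ bs zero ∣ + ∣ rest ∣
    ≤⟨ +-mono-≤ (bound zero) (∣concat∣≤∣support∣* (bs ∘ suc) (bound ∘ suc)) ⟩
  B + ∣ support (bs ∘ suc) ∣ * B ∎
  where
  open ≤-Reasoning
  rest = Vec.concat (Vec.tabulate (bs ∘ suc))
... | no empty = begin
  ∣ bs zero Vec.++ rest ∣    ≡⟨ ∣++∣ (bs zero) rest ⟩
  ∣ bs zero ∣ + ∣ rest ∣     ≡⟨ cong (λ b → ∣ b ∣ + ∣ rest ∣) (Empty-unique empty) ⟩
  ∣ ∅ {m} ∣ + ∣ rest ∣       ≡⟨ cong (_+ ∣ rest ∣) (∣⊥∣≡0 m) ⟩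
  ∣ rest ∣                   ≤⟨ ∣concat∣≤∣support∣* (bs ∘ suc) (bound ∘ suc) ⟩
  ∣ support (bs ∘ suc) ∣ * B ∎
  where
  open ≤-Reasoning
  rest = Vec.concat (Vec.tabulate (bs ∘ suc))

representative : {m : ℕ} → Subset (suc m) → Fin (suc m)
representative q with nonempty? q
... | yes (j , _) = j
... | no _        = zero

representative-∈ : {m : ℕ} {q : Subset (suc m)} → Nonempty q → representative q ∈ q
representative-∈ {q = q} ne with nonempty? q
... | yes (_ , j∈q) = j∈q
... | no empty      = ⊥-elim (empty ne)

η-lex : {p m A B : ℕ} {G : Graph p} {H : Graph m} →
  ηAtMost G A → ηAtMost H B → ηAtMost (lex G H) (A * B)
η-lex {p} {zero} _ _ S _ = ≤-trans (∣p∣≤n S) (≤-trans (≤-reflexive (*-zeroʳ p)) z≤n)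
η-lex {p} {suc m} {A} {B} {G} {H} ηG ηH S S-representable = begin
  ∣ S ∣                                ≡⟨ cong ∣_∣ (concat-blocks {p} S) ⟨
  ∣ Vec.concat (Vec.tabulate blocks) ∣ ≤⟨ ∣concat∣≤∣support∣* blocks block-bound ⟩
  ∣ support blocks ∣ * B               ≤⟨ *-monoˡ-≤ B support-bound ⟩
  A * B                                ∎
  where
  open ≤-Reasoning
  blocks : Fin p → Subset (suc m)
  blocks = block {p} {suc m} S

  block-bound : ∀ a → ∣ blocks a ∣ ≤ B
  block-bound a = ηH (blocks a) (Pullback.pullback H (lex G H) (combine a) (combine-injectiveʳ a _ a _)
    (blocks a) S (Equivalence.to (∈-block {p})) (λ {i} {j} _ _ _ → ⇔-sym (lex-adj-fibre G H a i j))
    S-representable)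

  support-bound : ∣ support blocks ∣ ≤ A
  support-bound = ηG (support blocks) (Pullback.pullback G (lex G H)
    (λ a → combine a (representative (blocks a))) (combine-injectiveˡ _ _ _ _) (support blocks) S
    (λ a∈T → Equivalence.to (∈-block {p}) (representative-∈ (∈-support {bs = blocks} a∈T)))
    (λ _ _ a≢b → ⇔-sym (lex-adj-base G H _ _ a≢b)) S-representable)

-- The base graph

neighbours : Fin 8 → List (Fin 8)
neighbours 0F = 2F ∷ 3F ∷ 4F ∷ 7F ∷ []
neighbours 1F = 2F ∷ 5F ∷ 6F ∷ 7F ∷ []
neighbours 2F = 0F ∷ 1F ∷ 4F ∷ 6F ∷ 7F ∷ []
neighbours 3F = 0F ∷ 4F ∷ 5F ∷ 6F ∷ 7F ∷ []
neighbours 4F = 0F ∷ 2F ∷ 3F ∷ 6F ∷ []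
neighbours 5F = 1F ∷ 3F ∷ 6F ∷ 7F ∷ []
neighbours 6F = 1F ∷ 2F ∷ 3F ∷ 4F ∷ 5F ∷ []
neighbours 7F = 0F ∷ 1F ∷ 2F ∷ 3F ∷ 5F ∷ []

adjacent : Fin 8 → Fin 8 → Bool
adjacent x y = does (Any.any? (y ≟_) (neighbours x))

G₈ : Graph 8
G₈ = record
  { Adj    = λ x y → T (adjacent x y)
  ; sym    = λ {x} {y} → subst T (adjacent-sym x y)
  ; irrefl = λ {x} → subst T (adjacent-irrefl x)
  }
  where
  adjacent-sym : ∀ x y → adjacent x y ≡ adjacent y x
  adjacent-sym = toWitness {a? = all? λ x → all? λ y → adjacent x y Bool.≟ adjacent y x} tt
  adjacent-irrefl : ∀ x → adjacent x x ≡ false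
  adjacent-irrefl = toWitness {a? = all? λ x → adjacent x x Bool.≟ false} tt

hubs : Vec (Fin 8) 4
hubs = 6F ∷ 3F ∷ 2F ∷ 7F ∷ []

rims : Vec (Vec (Fin 8) 5) 4
rims = (1F ∷ 2F ∷ 4F ∷ 3F ∷ 5F ∷ [])
     ∷ (0F ∷ 4F ∷ 6F ∷ 5F ∷ 7F ∷ [])
     ∷ (0F ∷ 4F ∷ 6F ∷ 1F ∷ 7F ∷ [])
     ∷ (0F ∷ 2F ∷ 1F ∷ 5F ∷ 3F ∷ [])
     ∷ []

hub : Fin 4 → Fin 8
hub = Vec.lookup hubs

rim : Fin 4 → Fin 5 → Fin 8
rim c = Vec.lookup (Vec.lookup rims c)

wheel : Fin 4 → Wheel G₈
wheel c = record
  { hub             = hub c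
  ; rim             = rim c
  ; spoke           = toWitness {a? = all? λ c → all? λ i →
                        T? (adjacent (hub c) (rim c i))} tt c
  ; rim-adjacent    = toWitness {a? = all? λ c → all? λ i →
                        T? (adjacent (rim c i) (rim c (next i)))} tt c
  ; rim-nonadjacent = toWitness {a? = all? λ c → all? λ i →
                        ¬? (T? (adjacent (rim c i) (rim c (next (next i)))))} tt c
  ; rim-distinct    = toWitness {a? = all? λ c → all? λ i →
                        ¬? (rim c i ≟ rim c (next (next i)))} tt c
  }

-- The four wheels avoid the vertex pairs {0,7}, {1,2}, {3,5} and {4,6}
-- respectively; these pairs partition the vertices, so any 7 vertices contain a wheel.
large-subset-contains-wheel : ∀ S → ¬ ∣ S ∣ ≤ 6 → ∃ λ c → hub c ∈ S × ∀ i → rim c i ∈ S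
large-subset-contains-wheel S large =
  decidable-stable (contains-wheel? S) (λ ∄c → no-counterexample (S , large , ∄c))
  where
  contains-wheel? : ∀ S → Dec (∃ λ c → hub c ∈ S × ∀ i → rim c i ∈ S)
  contains-wheel? S = any? λ c → (hub c ∈? S) ×-dec all? (λ i → rim c i ∈? S)
  no-counterexample : ¬ ∃ λ S → ¬ ∣ S ∣ ≤ 6 × ¬ ∃ λ c → hub c ∈ S × ∀ i → rim c i ∈ S
  no-counterexample =
    toWitnessFalse {a? = anySubset? λ S → ¬? (∣ S ∣ ≤? 6) ×-dec ¬? (contains-wheel? S)} tt

η-G₈ : ηAtMost G₈ 6
η-G₈ S S-representable with ∣ S ∣ ≤? 6
... | yes small = small
... | no large  =
  let c , hub∈S , rim⊆S = large-subset-contains-wheel S large in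
  ⊥-elim (wheel-not-representable (wheel c) hub∈S rim⊆S S-representable)

point : Graph 1
point = record { Adj = λ _ _ → ⊥ ; sym = λ () ; irrefl = λ () }

G₈^ : (k : ℕ) → Graph (8 ^ k)
G₈^ zero    = point
G₈^ (suc k) = lex G₈ (G₈^ k)

η-G₈^ : ∀ k → ηAtMost (G₈^ k) (6 ^ k)
η-G₈^ zero    S _ = ∣p∣≤n S
η-G₈^ (suc k)     = η-lex {G = G₈} {H = G₈^ k} η-G₈ (η-G₈^ k)

theorem13 : (k : ℕ) → 1 ≤ k → τAtMost (8 ^ k) (6 ^ k)
theorem13 k _ = G₈^ k , η-G₈^ k
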